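{- (1) MTL and $\mathrm{TPTL}_{=}$ are incomparable in expressive power. (2) MTL and $\mathrm{TPTL}_{\mathrm{un}}$ are incomparable. (3) $\mathrm{TPTL}_{\mathrm{un}}$ and $\mathrm{TPTL}_{=}$ are incomparable.
   Context: Data words: infinite sequences $(P_0,d_0)(P_1,d_1)\dots$ with $P_i\subseteq\mathcal{P}$ (finite set of propositions) and $d_i\in\mathbb{N}$. Intervals are integer intervals with endpoints in $\mathbb{Z}\cup\{\pm\infty\}$. MTL: $\varphi::=p\mid\neg\varphi\mid\varphi_1\wedge\varphi_2\mid\varphi_1\mathsf{U}_I\varphi_2$; $(w,i)\models\varphi_1\mathsf{U}_I\varphi_2$ iff there is $j>i$ with $(w,j)\models\varphi_2$, $d_j-d_i\in I$, and $(w,k)\models\varphi_1$ for all $i<k<j$; $w\models\varphi$ iff $(w,0)\models\varphi$. TPTL: $\varphi::=p\mid x\in I\mid\neg\varphi\mid\varphi_1\wedge\varphi_2\mid\varphi_1\mathsf{U}\varphi_2\mid x.\varphi$; $(w,i,\nu)\models x\in I$ iff $d_i-\nu(x)\in I$; $(w,i,\nu)\models x.\varphi$ iff $(w,i,\nu[x\mapsto d_i])\models\varphi$; $(w,i,\nu)\models\varphi_1\mathsf{U}\varphi_2$ iff there is $j>i$ with $(w,j,\nu)\models\varphi_2$ and $(w,k,\nu)\models\varphi_1$ for all $i<k<j$; $w\models\varphi$ iff $(w,0,\nu_0)\models\varphi$ with $\nu_0$ mapping all registers to $d_0$. $\mathsf{F}\varphi:=\mathrm{true}\,\mathsf{U}\,\varphi$,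 $\mathsf{X}\varphi:=\mathrm{false}\,\mathsf{U}\,\varphi$. $\mathrm{TPTL}_{=}$: TPTL formulas in which every constraint $x\in I$ has $I=[0,0]$. $\mathrm{TPTL}_{\mathrm{un}}$: formulas of the grammar $\varphi::=p\mid\neg\varphi\mid x\in I\mid\varphi_1\wedge\varphi_2\mid\mathsf{F}\varphi\mid\mathsf{X}\varphi\mid x.\varphi$. Two logics are incomparable if each has a formula that is not equivalent (same set of satisfying data words) to any formula of the other. -}

module Defs where

open import Data.Nat using (ℕ; suc; _<_)
open import Data.Integer as ℤ using (ℤ; +_; _-_)
open import Data.Fin using (Fin)
open import Data.Bool using (Bool; true)
open import Data.Product using (_×_; Σ; ∃; ∃-syntax; proj₁; proj₂)
open import Relation.Nullary using (¬_)
open import Relation.Binary.PropositionalEquality using (_≡_)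
open import Function.Bundles using (_⇔_)
open import Data.Unit using (⊤)
open import Data.Empty using (⊥)

-- Data words over a finite set of propositions 𝒫 = Fin n.
-- A position carries a subset P_i ⊆ 𝒫 (as a characteristic function)
-- and a datum d_i ∈ ℕ.

DataWord : ℕ → Set
DataWord n = ℕ → (Fin n → Bool) × ℕ

props : ∀ {n} → DataWord n → ℕ → Fin n → Bool
props w i = proj₁ (w i)

dat : ∀ {n} → DataWord n → ℕ → ℕ
dat w i = proj₂ (w i)

data Ext : Set where
  -∞   : Ext
  fin  : ℤ → Ext
  +∞   : Ext

data _≤ₑ_ : Ext → Ext → Set where
  -∞≤     : ∀ {e} → -∞ ≤ₑ e
  ≤+∞     : ∀ {e} → e ≤ₑ +∞
  fin≤fin : ∀ {a b} → a ℤ.≤ b → fin a ≤ₑ fin b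

record Interval : Set where
  constructor ⟦_,_⟧
  field
    lower : Ext
    upper : Ext

_∈ᴵ_ : ℤ → Interval → Set
z ∈ᴵ I = (Interval.lower I ≤ₑ fin z) × (fin z ≤ₑ Interval.upper I)

[0,0] : Interval
[0,0] = ⟦ fin (+ 0) , fin (+ 0) ⟧

diff : ℕ → ℕ → ℤ
diff a b = (+ a) - (+ b)

record Logic (n : ℕ) : Set₁ where
  field
    Formula : Set
    _⊨_     : DataWord n → Formula → Set

open Logic public

Equivalent : ∀ {n} (L₁ L₂ : Logic n) → Formula L₁ → Formula L₂ → Set
Equivalent L₁ L₂ φ ψ = ∀ w → (_⊨_ L₁ w φ) ⇔ (_⊨_ L₂ w ψ)

NotSubsumedBy : ∀ {n} (L₁ L₂ : Logic n) → Set
NotSubsumedBy L₁ L₂ = ∃[ φ ] (∀ (ψ : Formula L₂) → ¬ Equivalent L₁ L₂ φ ψ)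

Incomparable : ∀ {n} (L₁ L₂ : Logic n) → Set
Incomparable L₁ L₂ = NotSubsumedBy L₁ L₂ × NotSubsumedBy L₂ L₁

data MTLForm (n : ℕ) : Set where
  prop : Fin n → MTLForm n
  ¬ₘ_  : MTLForm n → MTLForm n
  _∧ₘ_ : MTLForm n → MTLForm n → MTLForm n
  _U[_]_ : MTLForm n → Interval → MTLForm n → MTLForm n

MTL-sat : ∀ {n} → DataWord n → ℕ → MTLForm n → Set
MTL-sat w i (prop p) = props w i p ≡ true
MTL-sat w i (¬ₘ φ) = ¬ MTL-sat w i φ
MTL-sat w i (φ ∧ₘ ψ) = MTL-sat w i φ × MTL-sat w i ψ
MTL-sat w i (φ U[ I ] ψ) =
  ∃[ j ] (i < j × MTL-sat w j ψ × diff (dat w j) (dat w i) ∈ᴵ I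
          × (∀ k → i < k → k < j → MTL-sat w k φ))

MTL : (n : ℕ) → Logic n
MTL n = record { Formula = MTLForm n ; _⊨_ = λ w φ → MTL-sat w 0 φ }

Register : Set
Register = ℕ

Valuation : Set
Valuation = Register → ℕ

_[_↦_] : Valuation → Register → ℕ → Valuation
(ν [ x ↦ d ]) y with Data.Nat._≟_ x y
... | Relation.Nullary.yes _ = d
... | Relation.Nullary.no  _ = ν y

data TPTLForm (n : ℕ) : Set where
  prop  : Fin n → TPTLForm n
  _∈ₜ_  : Register → Interval → TPTLForm n
  ¬ₜ_   : TPTLForm n → TPTLForm n
  _∧ₜ_  : TPTLForm n → TPTLForm n → TPTLForm n
  _Uₜ_  : TPTLForm n → TPTLForm n → TPTLForm n
  bind  : Register → TPTLForm n → TPTLForm n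

TPTL-sat : ∀ {n} → DataWord n → ℕ → Valuation → TPTLForm n → Set
TPTL-sat w i ν (prop p) = props w i p ≡ true
TPTL-sat w i ν (x ∈ₜ I) = diff (dat w i) (ν x) ∈ᴵ I
TPTL-sat w i ν (¬ₜ φ) = ¬ TPTL-sat w i ν φ
TPTL-sat w i ν (φ ∧ₜ ψ) = TPTL-sat w i ν φ × TPTL-sat w i ν ψ
TPTL-sat w i ν (φ Uₜ ψ) =
  ∃[ j ] (i < j × TPTL-sat w j ν ψ × (∀ k → i < k → k < j → TPTL-sat w k ν φ))
TPTL-sat w i ν (bind x φ) = TPTL-sat w i (ν [ x ↦ dat w i ]) φ

ν₀ : ∀ {n} → DataWord n → Valuation
ν₀ w _ = dat w 0

TPTL : (n : ℕ) → Logic n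
TPTL n = record { Formula = TPTLForm n ; _⊨_ = λ w φ → TPTL-sat w 0 (ν₀ w) φ }

OnlyEq : ∀ {n} → TPTLForm n → Set
OnlyEq (prop p) = ⊤
OnlyEq (x ∈ₜ I) = I ≡ [0,0]
OnlyEq (¬ₜ φ) = OnlyEq φ
OnlyEq (φ ∧ₜ ψ) = OnlyEq φ × OnlyEq ψ
OnlyEq (φ Uₜ ψ) = OnlyEq φ × OnlyEq ψ
OnlyEq (bind x φ) = OnlyEq φ

TPTL= : (n : ℕ) → Logic n
TPTL= n = record { Formula = Σ (TPTLForm n) OnlyEq
                 ; _⊨_ = λ w φ → TPTL-sat w 0 (ν₀ w) (proj₁ φ) }

-- TPTL_un : p | ¬φ | x ∈ I | φ ∧ φ | F φ | X φ | x.φ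
-- with F φ := true U φ and X φ := false U φ (semantics unfolded).

data TPTLunForm (n : ℕ) : Set where
  prop  : Fin n → TPTLunForm n
  ¬ᵤ_   : TPTLunForm n → TPTLunForm n
  _∈ᵤ_  : Register → Interval → TPTLunForm n
  _∧ᵤ_  : TPTLunForm n → TPTLunForm n → TPTLunForm n
  F     : TPTLunForm n → TPTLunForm n
  X     : TPTLunForm n → TPTLunForm n
  bind  : Register → TPTLunForm n → TPTLunForm n

TPTLun-sat : ∀ {n} → DataWord n → ℕ → Valuation → TPTLunForm n → Set
TPTLun-sat w i ν (prop p) = props w i p ≡ true
TPTLun-sat w i ν (¬ᵤ φ) = ¬ TPTLun-sat w i ν φ
TPTLun-sat w i ν (x ∈ᵤ I) = diff (dat w i) (ν x) ∈ᴵ I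
TPTLun-sat w i ν (φ ∧ᵤ ψ) = TPTLun-sat w i ν φ × TPTLun-sat w i ν ψ
TPTLun-sat w i ν (F φ) = ∃[ j ] (i < j × TPTLun-sat w j ν φ)
TPTLun-sat w i ν (X φ) = TPTLun-sat w (suc i) ν φ
TPTLun-sat w i ν (bind x φ) = TPTLun-sat w i (ν [ x ↦ dat w i ]) φ

TPTLun : (n : ℕ) → Logic n
TPTLun n = record { Formula = TPTLunForm n ; _⊨_ = λ w φ → TPTLun-sat w 0 (ν₀ w) φ }

-- Each logic is invariant under a transformation of data words that formulas of the
-- other two logics detect.  TPTL= only ever compares data for equality, so it cannot
-- see a positive rescaling of all data.  TPTLun can look ahead only through F, which
-- merely asks whether some suffix occurs later, and through at most d nested X, so a
-- periodic word and a shift of it that agree on their first d+1 letters satisfy the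
-- same TPTLun formulas.  MTL measures data only relative to the current position, and
-- on a word whose data form an arithmetic progression of step N from position 1 on,
-- every position from 1 on looks the same; hence an MTL formula whose constants are
-- all above -N cannot tell whether d₀ equals d₂ = 2N or d₃ = 3N.
module Submission where

open import Defs
open import Data.Nat using (ℕ; zero; suc; _+_; _*_; _≤_; _<_; z≤n; s≤s; z<s; s<s; _∸_; _⊔_; _≟_; _%_)
open import Data.Nat.Properties
open import Data.Nat.DivMod using ([m+kn]%n≡m%n; m<n⇒m%n≡m)
open import Data.Nat.Tactic.RingSolver using (solve-∀)
open import Data.Integer as ℤ using (+_; -[1+_]; _⊖_; -≤-; +≤+; -<-; -<+)
import Data.Integer.Properties as ℤP
open import Data.Fin using (Fin; zero)
open import Data.Bool using (Bool; true; false)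
open import Data.Product using (_×_; _,_; ∃-syntax; ∃₂; proj₁; proj₂)
open import Data.Product.Function.NonDependent.Propositional using (_×-⇔_)
open import Data.Sum using (inj₁; inj₂)
open import Data.Unit using (tt)
open import Data.Empty using (⊥-elim)
open import Function.Bundles using (_⇔_; mk⇔; Equivalence)
open Equivalence using (to; from)
import Function.Properties.Equivalence as ⇔
open import Function.Related.TypeIsomorphisms using (¬-cong-⇔)
open import Relation.Nullary using (¬_; yes; no)
open import Relation.Binary.Definitions using (tri<; tri≈; tri>)
open import Relation.Binary.PropositionalEquality

notSubsumedBy : ∀ {n} {L₁ L₂ : Logic n} (φ : Formula L₁) →
  (∀ ψ → ∃₂ λ w w' → _⊨_ L₁ w φ × ¬ _⊨_ L₁ w' φ × (_⊨_ L₂ w ψ → _⊨_ L₂ w' ψ)) →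
  NotSubsumedBy L₁ L₂
notSubsumedBy φ separate = φ , λ ψ φ≈ψ →
  let (w , w' , φ-w , ¬φ-w' , ψ-w→w') = separate ψ
  in ¬φ-w' (from (φ≈ψ w') (ψ-w→w' (to (φ≈ψ w) φ-w)))

subst-⇔ : ∀ {A : Set} (P : A → Set) {x y : A} → x ≡ y → P x ⇔ P y
subst-⇔ P refl = ⇔.refl

diff-cancelˡ : ∀ c a b → diff (c + a) (c + b) ≡ diff a b
diff-cancelˡ c a b = begin
  diff (c + a) (c + b) ≡⟨ ℤP.[+m]-[+n]≡m⊖n (c + a) (c + b) ⟩
  (c + a) ⊖ (c + b)    ≡⟨ ℤP.+-cancelˡ-⊖ c a b ⟩
  a ⊖ b                ≡⟨ ℤP.[+m]-[+n]≡m⊖n a b ⟨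
  diff a b             ∎
  where open ≡-Reasoning

diff-+ : ∀ a b → diff (a + b) a ≡ + b
diff-+ a b = begin
  diff (a + b) a  ≡⟨ ℤP.[+m]-[+n]≡m⊖n (a + b) a ⟩
  (a + b) ⊖ a     ≡⟨ ℤP.⊖-≥ (m≤m+n a b) ⟩
  + (a + b ∸ a)   ≡⟨ cong +_ (m+n∸m≡n a b) ⟩
  + b             ∎
  where open ≡-Reasoning

diff∈[0,0]⇒≡ : ∀ {a b} → diff a b ∈ᴵ [0,0] → a ≡ b
diff∈[0,0]⇒≡ {a} {b} (fin≤fin 0≤d , fin≤fin d≤0) =
  ℤP.+-injective (ℤP.i-j≡0⇒i≡j (+ a) (+ b) (ℤP.≤-antisym d≤0 0≤d))

≡⇒diff∈[0,0] : ∀ {a b} → a ≡ b → diff a b ∈ᴵ [0,0]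
≡⇒diff∈[0,0] {a} refl =
  fin≤fin (ℤP.≤-reflexive (sym a-a≡0)) , fin≤fin (ℤP.≤-reflexive a-a≡0)
  where
    a-a≡0 : diff a a ≡ + 0
    a-a≡0 = ℤP.+-inverseʳ (+ a)

[1,1] : Interval
[1,1] = ⟦ fin (+ 1) , fin (+ 1) ⟧

1∈[1,1] : diff 1 0 ∈ᴵ [1,1]
1∈[1,1] = fin≤fin (+≤+ ≤-refl) , fin≤fin (+≤+ ≤-refl)

diff-self∉[1,1] : ∀ a → ¬ diff a a ∈ᴵ [1,1]
diff-self∉[1,1] a a-a∈[1,1] with subst (_∈ᴵ [1,1]) (ℤP.+-inverseʳ (+ a)) a-a∈[1,1]
... | fin≤fin (+≤+ ()) , _

⊤ₘ : ∀ {n} → MTLForm (suc n)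
⊤ₘ = ¬ₘ (prop zero ∧ₘ (¬ₘ prop zero))

⊤ₘ-sat : ∀ {n} (w : DataWord (suc n)) i → MTL-sat w i ⊤ₘ
⊤ₘ-sat w i (p , ¬p) = ¬p p

Xₜ : ∀ {n} → TPTLForm (suc n) → TPTLForm (suc n)
Xₜ φ = (prop zero ∧ₜ (¬ₜ prop zero)) Uₜ φ

Xₜ-sat : ∀ {n} (w : DataWord (suc n)) {i ν} (φ : TPTLForm (suc n)) →
         TPTL-sat w i ν (Xₜ φ) ⇔ TPTL-sat w (suc i) ν φ
Xₜ-sat w {i} {ν} φ = mk⇔ next (λ φ₊ → suc i , ≤-refl , φ₊ , λ k i<k k<1+i → ⊥-elim (≤⇒≯ i<k k<1+i))
  where
    next : TPTL-sat w i ν (Xₜ φ) → TPTL-sat w (suc i) ν φ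
    next (j , i<j , φj , ⊥-before) with m≤n⇒m<n∨m≡n i<j
    ... | inj₂ refl = φj
    ... | inj₁ 1+i<j = let (p , ¬p) = ⊥-before (suc i) ≤-refl 1+i<j in ⊥-elim (¬p p)

-- TPTL= cannot see a rescaling of the data

scale : ∀ {n} → ℕ → DataWord n → DataWord n
scale c w i = props w i , c * dat w i

Scaled : ℕ → Valuation → Valuation → Set
Scaled c ν ν' = ∀ x → ν' x ≡ c * ν x

Scaled-[↦] : ∀ {c ν ν'} x d → Scaled c ν ν' → Scaled c (ν [ x ↦ d ]) (ν' [ x ↦ c * d ])
Scaled-[↦] x d s y with x ≟ y
... | yes _ = refl
... | no _ = s y

TPTL-sat-scale : ∀ {n} c (w : DataWord n) (φ : TPTLForm n) → OnlyEq φ → ∀ {i ν ν'} →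
  Scaled (suc c) ν ν' → TPTL-sat w i ν φ ⇔ TPTL-sat (scale (suc c) w) i ν' φ
TPTL-sat-scale c w (prop p) _ s = ⇔.refl
TPTL-sat-scale c w (x ∈ₜ _) refl {i} {ν} s = mk⇔
  (λ h → ≡⇒diff∈[0,0] (trans (cong (suc c *_) (diff∈[0,0]⇒≡ h)) (sym (s x))))
  (λ h → ≡⇒diff∈[0,0] (*-cancelˡ-≡ (dat w i) (ν x) (suc c) (trans (diff∈[0,0]⇒≡ h) (s x))))
TPTL-sat-scale c w (¬ₜ φ) eq s = ¬-cong-⇔ (TPTL-sat-scale c w φ eq s)
TPTL-sat-scale c w (φ ∧ₜ ψ) (eqφ , eqψ) s = TPTL-sat-scale c w φ eqφ s ×-⇔ TPTL-sat-scale c w ψ eqψ s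
TPTL-sat-scale c w (φ Uₜ ψ) (eqφ , eqψ) {ν = ν} {ν'} s = mk⇔
  (λ (j , i<j , ψj , φ-before) → j , i<j , to (ψ≈ j) ψj , λ k i<k k<j → to (φ≈ k) (φ-before k i<k k<j))
  (λ (j , i<j , ψj , φ-before) → j , i<j , from (ψ≈ j) ψj , λ k i<k k<j → from (φ≈ k) (φ-before k i<k k<j))
  where
    φ≈ : ∀ k → TPTL-sat w k ν φ ⇔ TPTL-sat (scale (suc c) w) k ν' φ
    ψ≈ : ∀ k → TPTL-sat w k ν ψ ⇔ TPTL-sat (scale (suc c) w) k ν' ψ
    φ≈ k = TPTL-sat-scale c w φ eqφ {k} s
    ψ≈ k = TPTL-sat-scale c w ψ eqψ {k} s
TPTL-sat-scale c w (bind x φ) eq {i} s = TPTL-sat-scale c w φ eq (Scaled-[↦] {suc c} x (dat w i) s)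

TPTL=-⊨-scale : ∀ {n} c (w : DataWord n) (φ : Formula (TPTL= n)) →
  _⊨_ (TPTL= n) w φ ⇔ _⊨_ (TPTL= n) (scale (suc c) w) φ
TPTL=-⊨-scale c w (φ , eq) = TPTL-sat-scale c w φ eq (λ _ → refl)

unitStep : ∀ {n} → DataWord n
unitStep zero    = (λ _ → false) , 0
unitStep (suc _) = (λ _ → false) , 1

MTL⊈TPTL= : ∀ n → NotSubsumedBy (MTL (suc n)) (TPTL= (suc n))
MTL⊈TPTL= n = notSubsumedBy (⊤ₘ U[ [1,1] ] ⊤ₘ) λ ψ →
  unitStep , scale 2 unitStep ,
  (1 , z<s , ⊤ₘ-sat (unitStep {suc n}) 1 , 1∈[1,1] , λ { zero () ; (suc _) _ (s≤s ()) }) ,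
  (λ { (suc _ , _ , _ , (_ , fin≤fin (+≤+ (s≤s ()))) , _) }) ,
  to (TPTL=-⊨-scale 1 unitStep ψ)

TPTLun⊈TPTL= : ∀ n → NotSubsumedBy (TPTLun (suc n)) (TPTL= (suc n))
TPTLun⊈TPTL= n = notSubsumedBy (F (0 ∈ᵤ [1,1])) λ ψ →
  unitStep , scale 2 unitStep ,
  (1 , z<s , 1∈[1,1]) ,
  (λ { (suc _ , _ , (_ , fin≤fin (+≤+ (s≤s ())))) }) ,
  to (TPTL=-⊨-scale 1 unitStep ψ)

-- TPTLun cannot tell apart words whose suffixes recur in each other

shift : ∀ {n} → ℕ → DataWord n → DataWord n
shift s w t = w (s + t)

RecursIn : ∀ {n} → DataWord n → DataWord n → Set
RecursIn w w' = ∀ j i → ∃[ j' ] (i < j' × shift j w ≗ shift j' w')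

AgreeUpTo : ∀ {n} → ℕ → DataWord n → DataWord n → Set
AgreeUpTo k w w' = ∀ t → t ≤ k → w t ≡ w' t

xDepth : ∀ {n} → TPTLunForm n → ℕ
xDepth (prop _)   = 0
xDepth (¬ᵤ φ)     = xDepth φ
xDepth (_ ∈ᵤ _)   = 0
xDepth (φ ∧ᵤ ψ)   = xDepth φ ⊔ xDepth ψ
xDepth (F φ)      = xDepth φ
xDepth (X φ)      = suc (xDepth φ)
xDepth (bind _ φ) = xDepth φ

module _ {n} {w w' : DataWord n} (w↪w' : RecursIn w w') (w'↪w : RecursIn w' w) where

  agree-head : ∀ {k i i'} → AgreeUpTo k (shift i w) (shift i' w') → w i ≡ w' i'
  agree-head {i = i} {i'} agree =
    subst₂ (λ x y → w x ≡ w' y) (+-identityʳ i) (+-identityʳ i') (agree 0 z≤n)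

  agree-tail : ∀ {k i i'} → AgreeUpTo (suc k) (shift i w) (shift i' w') →
               AgreeUpTo k (shift (suc i) w) (shift (suc i') w')
  agree-tail {i = i} {i'} agree t t≤k =
    subst₂ (λ x y → w x ≡ w' y) (+-suc i t) (+-suc i' t) (agree (suc t) (s≤s t≤k))

  TPTLun-sat-local : ∀ (φ : TPTLunForm n) {k i i'} ν → xDepth φ ≤ k →
    AgreeUpTo k (shift i w) (shift i' w') → TPTLun-sat w i ν φ ⇔ TPTLun-sat w' i' ν φ
  TPTLun-sat-local (prop p) ν _ agree = subst-⇔ (λ ℓ → proj₁ ℓ p ≡ true) (agree-head agree)
  TPTLun-sat-local (¬ᵤ φ) ν d agree = ¬-cong-⇔ (TPTLun-sat-local φ ν d agree)
  TPTLun-sat-local (x ∈ᵤ I) ν _ agree =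
    subst-⇔ (λ ℓ → diff (proj₂ ℓ) (ν x) ∈ᴵ I) (agree-head agree)
  TPTLun-sat-local (φ ∧ᵤ ψ) ν d agree =
    TPTLun-sat-local φ ν (m⊔n≤o⇒m≤o (xDepth φ) _ d) agree
      ×-⇔ TPTLun-sat-local ψ ν (m⊔n≤o⇒n≤o _ (xDepth ψ) d) agree
  TPTLun-sat-local (F φ) {i = i} {i'} ν d _ = mk⇔
    (λ (j , i<j , φj) → let (j' , i'<j' , same) = w↪w' j i'
       in j' , i'<j' , to (TPTLun-sat-local φ ν d (λ t _ → same t)) φj)
    (λ (j' , i'<j' , φj') → let (j , i<j , same) = w'↪w j' i
       in j , i<j , from (TPTLun-sat-local φ ν d (λ t _ → sym (same t))) φj')
  TPTLun-sat-local (X φ) {suc k} ν (s≤s d) agree = TPTLun-sat-local φ ν d (agree-tail agree)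
  TPTLun-sat-local (bind x φ) {i = i} {i'} ν d agree = ⇔.trans
    (TPTLun-sat-local φ (ν [ x ↦ dat w i ]) d agree)
    (subst-⇔ (λ ℓ → TPTLun-sat w' i' (ν [ x ↦ proj₂ ℓ ]) φ) (agree-head agree))

  TPTLun-⊨-local : ∀ (φ : TPTLunForm n) {k} → xDepth φ ≤ k → AgreeUpTo k w w' →
    _⊨_ (TPTLun n) w φ ⇔ _⊨_ (TPTLun n) w' φ
  TPTLun-⊨-local φ d agree = ⇔.trans
    (TPTLun-sat-local φ (ν₀ w) d agree)
    (subst-⇔ (λ ℓ → TPTLun-sat w' 0 (λ _ → proj₂ ℓ) φ) (agree-head {i = 0} {i' = 0} agree))

Periodic : ∀ {n} → ℕ → DataWord n → Set
Periodic p w = ∀ t q → w (t + q * p) ≡ w t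

periodic-recurs : ∀ {n p} {w : DataWord n} → Periodic (suc p) w →
                  ∀ a b → RecursIn (shift a w) (shift b w)
periodic-recurs {p = p} {w} periodic a b j i = j' , i<j' , λ t → begin
  w (a + (j + t))                           ≡⟨ periodic (a + (j + t)) (b + suc i) ⟨
  w (a + (j + t) + (b + suc i) * suc p)     ≡⟨ cong w (shuffle p a b i j t) ⟩
  w (b + (j' + t))                          ∎
  where
    open ≡-Reasoning
    j' : ℕ
    j' = a + j + p * b + suc i * suc p
    i<j' : i < j'
    i<j' = ≤-trans (m≤m*n (suc i) (suc p)) (m≤n+m _ _)
    shuffle : ∀ p a b i j t → a + (j + t) + (b + suc i) * suc p
                            ≡ b + (a + j + p * b + suc i * suc p + t)
    shuffle = solve-∀

Letter : ℕ → Set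
Letter n = (Fin n → Bool) × ℕ

-- word = (Aᵐ B Aᵐ C)^ω and word' is word shifted by half a period, so both start
-- with Aᵐ and then differ: B carries the datum 1, C the datum 0.
module HalfShift {n : ℕ} (K : ℕ) where

  m : ℕ
  m = suc K

  A B C : Letter (suc n)
  A = (λ _ → true) , 0
  B = (λ _ → false) , 1
  C = (λ _ → false) , 0

  period : ℕ
  period = suc m + suc m

  block : ℕ → Letter (suc n)
  block r with r ≟ m | r ≟ suc m + m
  ... | yes _ | _     = B
  ... | no _  | yes _ = C
  ... | no _  | no _  = A

  block-A : ∀ {r} → r ≢ m → r ≢ suc m + m → block r ≡ A
  block-A {r} r≢m r≢2m+1 with r ≟ m | r ≟ suc m + m
  ... | yes r≡m | _         = ⊥-elim (r≢m r≡m)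
  ... | no _    | yes r≡2m+1 = ⊥-elim (r≢2m+1 r≡2m+1)
  ... | no _    | no _      = refl

  block-B : block m ≡ B
  block-B with m ≟ m | m ≟ suc m + m
  ... | yes _  | _ = refl
  ... | no m≢m | _ = ⊥-elim (m≢m refl)

  block-C : block (suc m + m) ≡ C
  block-C with suc m + m ≟ m | suc m + m ≟ suc m + m
  ... | yes 2m+1≡m | _ = ⊥-elim (<⇒≢ (s≤s (m≤m+n m m)) (sym 2m+1≡m))
  ... | no _ | yes _ = refl
  ... | no _ | no ne = ⊥-elim (ne refl)

  word word' : DataWord (suc n)
  word t = block (t % period)
  word' = shift (suc m) word

  word-periodic : Periodic period word
  word-periodic t q = cong block ([m+kn]%n≡m%n t q period)

  word≡block : ∀ {r} → r < period → word r ≡ block r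
  word≡block r<period = cong block (m<n⇒m%n≡m r<period)

  word-prefix : ∀ {t} → t < m → word t ≡ A
  word-prefix t<m = trans (word≡block (<-≤-trans t<m (≤-trans (n≤1+n m) (m≤m+n (suc m) (suc m)))))
    (block-A (<⇒≢ t<m) (<⇒≢ (<-≤-trans t<m (m≤n+m m (suc m)))))

  word'-prefix : ∀ {t} → t < m → word' t ≡ A
  word'-prefix {t} t<m = trans (word≡block (+-monoʳ-< (suc m) (m<n⇒m<1+n t<m)))
    (block-A (λ eq → <⇒≢ (s≤s (m≤m+n m t)) (sym eq)) (λ eq → <⇒≢ t<m (+-cancelˡ-≡ (suc m) t m eq)))

  word-marker : word m ≡ B
  word-marker = trans (word≡block (s≤s (m≤m+n m (suc m)))) block-B

  word'-marker : word' m ≡ C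
  word'-marker = trans (word≡block (+-monoʳ-< (suc m) (n<1+n m))) block-C

  word↪word' : RecursIn word word'
  word↪word' = periodic-recurs word-periodic 0 (suc m)

  word'↪word : RecursIn word' word
  word'↪word = periodic-recurs word-periodic (suc m) 0

  word≈word' : AgreeUpTo K word word'
  word≈word' t t≤K = trans (word-prefix (s≤s t≤K)) (sym (word'-prefix (s≤s t≤K)))

  p-at : DataWord (suc n) → ℕ → Set
  p-at v k = props v k zero ≡ true

  word-p-before-marker : ∀ k → 0 < k → k < m → p-at word k
  word-p-before-marker k _ k<m = cong (λ ℓ → proj₁ ℓ zero) (word-prefix k<m)

  word'-stalls : ∀ {j} → (∀ k → 0 < k → k < j → p-at word' k) → dat word' j ≡ dat word' 0
  word'-stalls {j} p-before with <-cmp j m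
  ... | tri< j<m _ _ = cong proj₂ (trans (word'-prefix j<m) (sym (word'-prefix z<s)))
  ... | tri≈ _ refl _ = trans (cong proj₂ word'-marker) (sym (cong proj₂ (word'-prefix z<s)))
  ... | tri> _ _ m<j with trans (sym (cong (λ ℓ → proj₁ ℓ zero) word'-marker)) (p-before m z<s m<j)
  ...   | ()

  pU[1,1]⊤-word : MTL-sat word 0 (prop zero U[ [1,1] ] ⊤ₘ)
  pU[1,1]⊤-word = m , z<s , ⊤ₘ-sat word m ,
    subst₂ (λ d d₀ → diff d d₀ ∈ᴵ [1,1]) (sym (cong proj₂ word-marker)) (sym (cong proj₂ (word-prefix z<s))) 1∈[1,1] ,
    word-p-before-marker

  ¬pU[1,1]⊤-word' : ¬ MTL-sat word' 0 (prop zero U[ [1,1] ] ⊤ₘ)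
  ¬pU[1,1]⊤-word' (j , _ , _ , j∈[1,1] , p-before) = diff-self∉[1,1] (dat word' 0)
    (subst (λ d → diff d (dat word' 0) ∈ᴵ [1,1]) (word'-stalls p-before) j∈[1,1])

  pU≠-word : TPTL-sat word 0 (ν₀ word) (prop zero Uₜ (¬ₜ (0 ∈ₜ [0,0])))
  pU≠-word = m , z<s , marker≢start , word-p-before-marker
    where
      marker≢start : ¬ diff (dat word m) (dat word 0) ∈ᴵ [0,0]
      marker≢start same with trans (sym (cong proj₂ word-marker))
                              (trans (diff∈[0,0]⇒≡ {dat word m} same) (cong proj₂ (word-prefix z<s)))
      ... | ()

  ¬pU≠-word' : ¬ TPTL-sat word' 0 (ν₀ word') (prop zero Uₜ (¬ₜ (0 ∈ₜ [0,0])))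
  ¬pU≠-word' (j , _ , changed , p-before) = changed (≡⇒diff∈[0,0] (word'-stalls p-before))

  TPTLun-word→word' : ∀ ψ → xDepth ψ ≤ K → _⊨_ (TPTLun (suc n)) word ψ → _⊨_ (TPTLun (suc n)) word' ψ
  TPTLun-word→word' ψ d = to (TPTLun-⊨-local word↪word' word'↪word ψ d word≈word')

MTL⊈TPTLun : ∀ n → NotSubsumedBy (MTL (suc n)) (TPTLun (suc n))
MTL⊈TPTLun n = notSubsumedBy (prop zero U[ [1,1] ] ⊤ₘ) λ ψ →
  let open HalfShift {n} (xDepth ψ)
  in word , word' , pU[1,1]⊤-word , ¬pU[1,1]⊤-word' , TPTLun-word→word' ψ ≤-refl

TPTL=⊈TPTLun : ∀ n → NotSubsumedBy (TPTL= (suc n)) (TPTLun (suc n))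
TPTL=⊈TPTLun n = notSubsumedBy (prop zero Uₜ (¬ₜ (0 ∈ₜ [0,0])) , tt , refl) λ ψ →
  let open HalfShift {n} (xDepth ψ)
  in word , word' , pU≠-word , ¬pU≠-word' , TPTLun-word→word' ψ ≤-refl

-- MTL with bounded constants cannot locate d₀ inside a progression

negPart : Ext → ℕ
negPart (fin -[1+ k ]) = suc k
negPart _              = 0

negBound : ∀ {n} → MTLForm n → ℕ
negBound (prop _)                  = 0
negBound (¬ₘ φ)                    = negBound φ
negBound (φ ∧ₘ ψ)                  = negBound φ ⊔ negBound ψ
negBound (φ U[ ⟦ lo , hi ⟧ ] ψ) = (negPart lo ⊔ negPart hi) ⊔ (negBound φ ⊔ negBound ψ)

-[1+]<fin : ∀ {M z} → negPart (fin z) ≤ M → -[1+ M ] ℤ.< z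
-[1+]<fin {z = + _}      _   = -<+
-[1+]<fin {z = -[1+ _ ]} k<M = -<- k<M

∈-below : ∀ {M lo hi z z'} → negPart lo ≤ M → negPart hi ≤ M →
          z ℤ.≤ -[1+ M ] → z' ℤ.≤ -[1+ M ] → z ∈ᴵ ⟦ lo , hi ⟧ → z' ∈ᴵ ⟦ lo , hi ⟧
∈-below {M} lo≤M hi≤M z≤ z'≤ (lo≤z , z≤hi) = lower lo≤M lo≤z , upper hi≤M z≤hi
  where
    lower : ∀ {lo} → negPart lo ≤ M → lo ≤ₑ fin _ → lo ≤ₑ fin _
    lower _    -∞≤           = -∞≤
    lower l≤M (fin≤fin l≤z) = ⊥-elim (ℤP.<⇒≱ (-[1+]<fin l≤M) (ℤP.≤-trans l≤z z≤))
    upper : ∀ {hi} → negPart hi ≤ M → fin _ ≤ₑ hi → fin _ ≤ₑ hi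
    upper _    ≤+∞         = ≤+∞
    upper h≤M (fin≤fin _) = fin≤fin (ℤP.≤-trans z'≤ (ℤP.<⇒≤ (-[1+]<fin h≤M)))

module _ {n : ℕ} (N : ℕ) where

  progression : ℕ → DataWord n
  progression a zero    = (λ _ → false) , a
  progression a (suc t) = (λ _ → false) , suc t * N

  diff-progression : ∀ a u s → diff (dat (progression a) (suc u + s)) (dat (progression a) (suc u)) ≡ + (s * N)
  diff-progression a u s =
    trans (cong (λ d → diff d (suc u * N)) (*-distribʳ-+ N (suc u) s)) (diff-+ (suc u * N) (s * N))

  MTL-sat-progression-tail : ∀ (φ : MTLForm n) a b u u' →
    MTL-sat (progression a) (suc u) φ → MTL-sat (progression b) (suc u') φ
  MTL-sat-progression-tail (prop p) a b u u' p-holds = p-holds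
  MTL-sat-progression-tail (¬ₘ φ) a b u u' ¬φ φ' = ¬φ (MTL-sat-progression-tail φ b a u' u φ')
  MTL-sat-progression-tail (φ ∧ₘ ψ) a b u u' (φu , ψu) =
    MTL-sat-progression-tail φ a b u u' φu , MTL-sat-progression-tail ψ a b u u' ψu
  MTL-sat-progression-tail (φ U[ I ] ψ) a b u u' (j , u<j , ψj , j∈I , φ-before)
    with m≤n⇒∃[o]m+o≡n (<⇒≤ u<j)
  ... | zero , refl = ⊥-elim (<-irrefl (sym (+-identityʳ (suc u))) u<j)
  ... | suc r , refl =
    suc u' + suc r , m<m+n (suc u') z<s ,
    MTL-sat-progression-tail ψ a b (u + suc r) (u' + suc r) ψj ,
    subst (_∈ᴵ I) (trans (diff-progression a u (suc r)) (sym (diff-progression b u' (suc r)))) j∈I ,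
    φ-between r φ-before
    where
      -- every position after 0 satisfies the same formulas, so one witness suffices
      φ-between : ∀ r → (∀ k → suc u < k → k < suc u + suc r → MTL-sat (progression a) k φ) →
                  ∀ k → suc u' < k → k < suc u' + suc r → MTL-sat (progression b) k φ
      φ-between zero _ k u'<k k<u'+1 =
        ⊥-elim (≤⇒≯ (m<1+n⇒m≤n (subst (k <_) (+-comm (suc u') 1) k<u'+1)) u'<k)
      φ-between (suc r) φ-before (suc k) _ _ =
        MTL-sat-progression-tail φ a b (u + 1) k
          (φ-before (suc u + 1) (m<m+n (suc u) z<s) (+-monoʳ-< (suc u) (s≤s z<s)))

module _ {n : ℕ} (M : ℕ) where
  private
    N : ℕ
    N = suc M
    w₂ w₃ : DataWord n
    w₂ = progression N (2 * N)
    w₃ = progression N (3 * N)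

  first-gap₂ : diff (dat w₂ 1) (dat w₂ 0) ℤ.≤ -[1+ M ]
  first-gap₂ = subst (ℤ._≤ -[1+ M ]) (sym (diff-cancelˡ N 0 (N + 0))) (-≤- (m≤m+n M 0))

  first-gap₃ : diff (dat w₃ 1) (dat w₃ 0) ℤ.≤ -[1+ M ]
  first-gap₃ = subst (ℤ._≤ -[1+ M ]) (sym (diff-cancelˡ N 0 (N + (N + 0)))) (-≤- (m≤m+n M (N + 0)))

  later-gap : ∀ s → diff (dat w₃ (suc (suc s))) (dat w₃ 0) ≡ diff (dat w₂ (suc s)) (dat w₂ 0)
  later-gap s = diff-cancelˡ N (suc s * N) (2 * N)

  MTL-sat-progression-head : ∀ (φ : MTLForm n) → negBound φ ≤ M → MTL-sat w₂ 0 φ ⇔ MTL-sat w₃ 0 φ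
  MTL-sat-progression-head (prop p) _ = ⇔.refl
  MTL-sat-progression-head (¬ₘ φ) b = ¬-cong-⇔ (MTL-sat-progression-head φ b)
  MTL-sat-progression-head (φ ∧ₘ ψ) b =
    MTL-sat-progression-head φ (m⊔n≤o⇒m≤o (negBound φ) _ b)
      ×-⇔ MTL-sat-progression-head ψ (m⊔n≤o⇒n≤o _ (negBound ψ) b)
  MTL-sat-progression-head (φ U[ ⟦ lo , hi ⟧ ] ψ) b = mk⇔ forward backward
    where
      I : Interval
      I = ⟦ lo , hi ⟧
      lo≤M : negPart lo ≤ M
      lo≤M = m⊔n≤o⇒m≤o (negPart lo) _ (m⊔n≤o⇒m≤o (negPart lo ⊔ negPart hi) _ b)
      hi≤M : negPart hi ≤ M
      hi≤M = m⊔n≤o⇒n≤o _ (negPart hi) (m⊔n≤o⇒m≤o (negPart lo ⊔ negPart hi) _ b)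
      tail : ∀ (χ : MTLForm n) a b u u' →
             MTL-sat (progression N a) (suc u) χ → MTL-sat (progression N b) (suc u') χ
      tail = MTL-sat-progression-tail N

      forward : MTL-sat w₂ 0 (φ U[ I ] ψ) → MTL-sat w₃ 0 (φ U[ I ] ψ)
      forward (suc zero , _ , ψ1 , 1∈I , _) =
        1 , z<s , tail ψ _ _ 0 0 ψ1 , ∈-below lo≤M hi≤M first-gap₂ first-gap₃ 1∈I ,
        λ { zero () ; (suc _) _ (s≤s ()) }
      forward (suc (suc s) , _ , ψj , j∈I , φ-before) =
        suc (suc (suc s)) , z<s , tail ψ _ _ (suc s) (suc (suc s)) ψj ,
        subst (_∈ᴵ I) (sym (later-gap (suc s))) j∈I ,
        λ { zero () ; (suc k) _ _ → tail φ _ _ 0 k (φ-before 1 z<s (s<s z<s)) }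

      backward : MTL-sat w₃ 0 (φ U[ I ] ψ) → MTL-sat w₂ 0 (φ U[ I ] ψ)
      backward (suc zero , _ , ψ1 , 1∈I , _) =
        1 , z<s , tail ψ _ _ 0 0 ψ1 , ∈-below lo≤M hi≤M first-gap₃ first-gap₂ 1∈I ,
        λ { zero () ; (suc _) _ (s≤s ()) }
      backward (suc (suc s) , _ , ψj , j∈I , φ-before) =
        suc s , z<s , tail ψ _ _ (suc s) s ψj ,
        subst (_∈ᴵ I) (later-gap s) j∈I ,
        λ { zero () ; (suc k) _ _ → tail φ _ _ 0 k (φ-before 1 z<s (s<s z<s)) }

XₜXₜ[x=d₀]⇔d₂≡d₀ : ∀ {n} (w : DataWord (suc n)) →
  TPTL-sat w 0 (ν₀ w) (Xₜ (Xₜ (0 ∈ₜ [0,0]))) ⇔ dat w 2 ≡ dat w 0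
XₜXₜ[x=d₀]⇔d₂≡d₀ w = ⇔.trans (Xₜ-sat w {ν = ν₀ w} (Xₜ (0 ∈ₜ [0,0])))
  (⇔.trans (Xₜ-sat w {ν = ν₀ w} (0 ∈ₜ [0,0])) (mk⇔ diff∈[0,0]⇒≡ ≡⇒diff∈[0,0]))

2N≢3N : ∀ N → 2 * suc N ≢ 3 * suc N
2N≢3N N eq with *-cancelʳ-≡ 2 3 (suc N) eq
... | ()

TPTL=⊈MTL : ∀ n → NotSubsumedBy (TPTL= (suc n)) (MTL (suc n))
TPTL=⊈MTL n = notSubsumedBy (Xₜ (Xₜ (0 ∈ₜ [0,0])) , (tt , tt) , (tt , tt) , refl) λ ψ →
  let N = suc (negBound ψ) in
  progression N (2 * N) , progression N (3 * N) ,
  from (XₜXₜ[x=d₀]⇔d₂≡d₀ (progression N (2 * N))) refl ,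
  (λ h → 2N≢3N (negBound ψ) (to (XₜXₜ[x=d₀]⇔d₂≡d₀ (progression N (3 * N))) h)) ,
  to (MTL-sat-progression-head (negBound ψ) ψ ≤-refl)

TPTLun⊈MTL : ∀ n → NotSubsumedBy (TPTLun (suc n)) (MTL (suc n))
TPTLun⊈MTL n = notSubsumedBy (X (X (0 ∈ᵤ [0,0]))) λ ψ →
  let N = suc (negBound ψ) in
  progression N (2 * N) , progression N (3 * N) ,
  ≡⇒diff∈[0,0] {2 * N} refl ,
  (λ h → 2N≢3N (negBound ψ) (diff∈[0,0]⇒≡ {2 * N} h)) ,
  to (MTL-sat-progression-head (negBound ψ) ψ ≤-refl)

corollary2 : (n : ℕ) →
    Incomparable (MTL (suc n)) (TPTL= (suc n))
    × Incomparable (MTL (suc n)) (TPTLun (suc n))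
    × Incomparable (TPTLun (suc n)) (TPTL= (suc n))
corollary2 n = (MTL⊈TPTL= n , TPTL=⊈MTL n) ,
               (MTL⊈TPTLun n , TPTLun⊈MTL n) ,
               (TPTLun⊈TPTL= n , TPTL=⊈TPTLun n)
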